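{- For each proximity $\vee$-semilattice $S$, there exists a strong proximity $\vee$-semilattice $S'$ which is isomorphic to $S$ in $\mathsf{PxJLat}$.
   Context: Work constructively. A proximity poset is $(S,\le,\prec)$ with $(S,\le)$ a poset and $\prec$ a relation on $S$ such that for every $a$: $\{b\mid b\prec a\}$ is a rounded ideal (a downward closed, inhabited, upward directed set $I$ with $x\in I\iff\exists y\,(x\prec y\ \&\ y\in I)$) and $\{b\mid a\prec b\}$ is a rounded upward closed set ($x\in U\iff\exists y\,(y\prec x\ \&\ y\in U)$). An approximable relation $(S,\prec)\to(S',\prec')$ is $r\subseteq S\times S'$ such that $\{a\mid a\,r\,b\}$ is a rounded ideal for each $b\in S'$ and $\{b\mid a\,r\,b\}$ is a rounded upward closed set for each $a\in S$. A proximity $\vee$-semilattice is a proximity poset whose underlying poset is a join-semilattice $(S,0,\vee)$; it is strong if $a\prec 0\Rightarrow a=0$ and $a\prec b\vee c\Rightarrow\exists b',c'\,(a\le b'\vee c'\ \&\ b'\prec b\ \&\ c'\prec c)$. $\mathsf{PxJLat}$ is the category of proximity $\vee$-semilattices and approximable relations, with identity on $(S,\prec)$ the relation $\prec$ and composition relational composition. -}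

module Defs where

open import Level using (Level; suc)
open import Data.Product using (Σ; ∃; ∃-syntax; _×_; _,_)
open import Relation.Binary.Core using (Rel; REL)
open import Relation.Binary.Lattice.Structures using (IsBoundedJoinSemilattice)
open import Relation.Unary using (Pred)
open import Function.Bundles using (_⇔_)

record IsRoundedIdeal {ℓ} {A : Set ℓ} (_≤_ _≺_ : Rel A ℓ) (I : Pred A ℓ) : Set ℓ where
  field
    downClosed : ∀ {x y} → x ≤ y → I y → I x
    inhabited  : ∃[ x ] I x
    directed   : ∀ {x y} → I x → I y → ∃[ z ] (I z × x ≤ z × y ≤ z)
    rounded    : ∀ x → I x ⇔ (∃[ y ] (x ≺ y × I y))

record IsRoundedUpper {ℓ} {A : Set ℓ} (_≤_ _≺_ : Rel A ℓ) (U : Pred A ℓ) : Set ℓ where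
  field
    upClosed : ∀ {x y} → x ≤ y → U x → U y
    rounded  : ∀ x → U x ⇔ (∃[ y ] (y ≺ x × U y))

record ProximityJoinSemilattice (ℓ : Level) : Set (suc ℓ) where
  field
    Carrier : Set ℓ
    _≈_     : Rel Carrier ℓ
    _≤_     : Rel Carrier ℓ
    _≺_     : Rel Carrier ℓ
    _∨_     : Carrier → Carrier → Carrier
    𝟘       : Carrier
    isBoundedJoinSemilattice : IsBoundedJoinSemilattice _≈_ _≤_ _∨_ 𝟘
    below-isRoundedIdeal : ∀ a → IsRoundedIdeal _≤_ _≺_ (λ b → b ≺ a)
    above-isRoundedUpper : ∀ a → IsRoundedUpper _≤_ _≺_ (λ b → a ≺ b)

record IsStrong {ℓ} (S : ProximityJoinSemilattice ℓ) : Set ℓ where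
  open ProximityJoinSemilattice S
  field
    ≺𝟘⇒≈𝟘 : ∀ (a : Carrier) → a ≺ 𝟘 → a ≈ 𝟘
    ≺∨-split : ∀ (a b c : Carrier) → a ≺ (b ∨ c) →
      Σ Carrier λ b′ → Σ Carrier λ c′ → (a ≤ (b′ ∨ c′) × b′ ≺ b × c′ ≺ c)

open ProximityJoinSemilattice

record IsApproximable {ℓ} (S S′ : ProximityJoinSemilattice ℓ)
    (r : REL (Carrier S) (Carrier S′) ℓ) : Set ℓ where
  field
    ideal : ∀ b → IsRoundedIdeal (_≤_ S) (_≺_ S) (λ a → r a b)
    upper : ∀ a → IsRoundedUpper (_≤_ S′) (_≺_ S′) (λ b → r a b)

record PxHom {ℓ} (S S′ : ProximityJoinSemilattice ℓ) : Set (suc ℓ) where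
  field
    rel          : REL (Carrier S) (Carrier S′) ℓ
    approximable : IsApproximable S S′ rel

open PxHom

idRel : ∀ {ℓ} (S : ProximityJoinSemilattice ℓ) → Rel (Carrier S) ℓ
idRel S = _≺_ S

_∘ʳ_ : ∀ {ℓ} {A B C : Set ℓ} → REL B C ℓ → REL A B ℓ → REL A C ℓ
(s ∘ʳ r) a c = ∃[ b ] (r a b × s b c)

_≐_ : ∀ {ℓ} {A B : Set ℓ} → REL A B ℓ → REL A B ℓ → Set ℓ
r ≐ s = ∀ a b → r a b ⇔ s a b

record PxIso {ℓ} (S S′ : ProximityJoinSemilattice ℓ) : Set (suc ℓ) where
  field
    to   : PxHom S S′
    from : PxHom S′ S
    from∘to : (rel from ∘ʳ rel to) ≐ idRel S
    to∘from : (rel to ∘ʳ rel from) ≐ idRel S′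

module Submission where

-- Present S by finite lists of its elements read as formal joins: L stands for the rounded
-- ideal ⟦ L ⟧ = ⋃ { ↓ ⋁ M | M ≺ L pointwise }, lists are ordered by inclusion of these ideals
-- and joined by concatenation, and L ≺ K means ⟦ L ⟧ ⊆ ↓ y for some y ∈ ⟦ K ⟧.  Strongness is
-- then built in, because a witness M ≺ K ++ K′ splits as N ++ N′ with N ≺ K and N′ ≺ K′.
-- The isomorphism relates a to L when a ∈ ⟦ L ⟧ and L to a when ⟦ L ⟧ ⊆ ↓ y for some y ≺ a;
-- by roundedness both composites are ≺ again.

open import Defs
open import Level using (Level)
open import Data.Product using (Σ; _×_; _,_; ∃-syntax; map₂; swap)
open import Data.List using (List; []; _∷_; [_]; _++_; foldr)
open import Data.List.Relation.Binary.Pointwise using (Pointwise; []; _∷_; ++⁺; foldr⁺)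
open import Function using (_on_)
open import Function.Bundles using (_⇔_; mk⇔; module Equivalence)
open import Function.Properties.Equivalence using () renaming (sym to ⇔-sym)
open import Relation.Binary.Core using (Rel)
open import Relation.Binary.PropositionalEquality using (_≡_; refl)
open import Relation.Binary.Structures using (IsPartialOrder)
open import Relation.Binary.Lattice.Structures using (IsBoundedJoinSemilattice)
import Relation.Binary.Construct.On as On
open import Relation.Unary using (Pred; _∈_; _⊆_) renaming (_≐_ to _≐ₚ_)
open import Relation.Unary.Properties
  using (⊆-reflexive; ⊆-trans; ⊆-antisym; ≐-refl; ≐-sym; ≐-trans)

⊆-isPartialOrder : ∀ {a ℓ} {A : Set a} → IsPartialOrder {A = Pred A ℓ} _≐ₚ_ _⊆_
⊆-isPartialOrder = record
  { isPreorder = record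
    { isEquivalence = record { refl = ≐-refl ; sym = ≐-sym ; trans = ≐-trans }
    ; reflexive     = ⊆-reflexive
    ; trans         = ⊆-trans
    }
  ; antisym = ⊆-antisym
  }

pointwise-++⁻ʳ : ∀ {a b ℓ} {A : Set a} {B : Set b} {R : A → B → Set ℓ} {M} K K′ →
  Pointwise R M (K ++ K′) →
  ∃[ N ] ∃[ N′ ] (M ≡ N ++ N′ × Pointwise R N K × Pointwise R N′ K′)
pointwise-++⁻ʳ []      K′ rs       = [] , _ , refl , [] , rs
pointwise-++⁻ʳ (_ ∷ K) K′ (r ∷ rs) with pointwise-++⁻ʳ K K′ rs
... | N , N′ , refl , rsₗ , rsᵣ = _ ∷ N , N′ , refl , r ∷ rsₗ , rsᵣ

module StrongPresentation {ℓ : Level} (S : ProximityJoinSemilattice ℓ) where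
  open ProximityJoinSemilattice S
  open IsBoundedJoinSemilattice isBoundedJoinSemilattice
    using (x≤x∨y; y≤x∨y; ∨-least; minimum) renaming (refl to ≤-refl; trans to ≤-trans)

  ↓ : Carrier → Pred Carrier ℓ
  ↓ a x = x ≺ a

  module RoundedIdeal {I : Pred Carrier ℓ} (isI : IsRoundedIdeal _≤_ _≺_ I) where
    open IsRoundedIdeal isI public using (downClosed)

    ≺-closed : ∀ {x y} → x ≺ y → y ∈ I → x ∈ I
    ≺-closed {x} {y} x≺y y∈I = Equivalence.from (IsRoundedIdeal.rounded isI x) (y , x≺y , y∈I)

    interpolate : ∀ {x} → x ∈ I → ∃[ y ] (x ≺ y × y ∈ I)
    interpolate {x} = Equivalence.to (IsRoundedIdeal.rounded isI x)

    ∨-closed : ∀ {x y} → x ∈ I → y ∈ I → (x ∨ y) ∈ I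
    ∨-closed x∈I y∈I with IsRoundedIdeal.directed isI x∈I y∈I
    ... | z , z∈I , x≤z , y≤z = downClosed (∨-least x≤z y≤z) z∈I

    𝟘-closed : 𝟘 ∈ I
    𝟘-closed with IsRoundedIdeal.inhabited isI
    ... | x , x∈I = downClosed (minimum x) x∈I

  module ↓ a = RoundedIdeal (below-isRoundedIdeal a)

  ≤-≺-trans : ∀ {x y a} → x ≤ y → y ≺ a → x ≺ a
  ≤-≺-trans {a = a} = ↓.downClosed a

  ≺-≤-trans : ∀ {a x y} → a ≺ x → x ≤ y → a ≺ y
  ≺-≤-trans {a} a≺x x≤y = IsRoundedUpper.upClosed (above-isRoundedUpper a) x≤y a≺x

  ≺-trans : ∀ {x y z} → x ≺ y → y ≺ z → x ≺ z
  ≺-trans {z = z} = ↓.≺-closed z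

  ≺-interpolate : ∀ {x z} → x ≺ z → ∃[ y ] (x ≺ y × y ≺ z)
  ≺-interpolate {z = z} = ↓.interpolate z

  ∨-mono-≤ : ∀ {a b c d} → a ≤ b → c ≤ d → (a ∨ c) ≤ (b ∨ d)
  ∨-mono-≤ a≤b c≤d = ∨-least (≤-trans a≤b (x≤x∨y _ _)) (≤-trans c≤d (y≤x∨y _ _))

  ∨-mono-≺ : ∀ {a b c d} → a ≺ b → c ≺ d → (a ∨ c) ≺ (b ∨ d)
  ∨-mono-≺ a≺b c≺d = ↓.∨-closed _ (≺-≤-trans a≺b (x≤x∨y _ _)) (≺-≤-trans c≺d (y≤x∨y _ _))

  ⋁ : List Carrier → Carrier
  ⋁ = foldr _∨_ 𝟘

  ⋁-++ : ∀ L K → ⋁ (L ++ K) ≤ (⋁ L ∨ ⋁ K)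
  ⋁-++ []      K = y≤x∨y _ _
  ⋁-++ (x ∷ L) K = ∨-least (≤-trans (x≤x∨y _ _) (x≤x∨y _ _))
                           (≤-trans (⋁-++ L K) (∨-mono-≤ (y≤x∨y _ _) ≤-refl))

  ⋁-++ˡ : ∀ L K → ⋁ L ≤ ⋁ (L ++ K)
  ⋁-++ˡ []      K = minimum _
  ⋁-++ˡ (x ∷ L) K = ∨-mono-≤ ≤-refl (⋁-++ˡ L K)

  ⋁-++ʳ : ∀ L K → ⋁ K ≤ ⋁ (L ++ K)
  ⋁-++ʳ []      K = ≤-refl
  ⋁-++ʳ (x ∷ L) K = ≤-trans (⋁-++ʳ L K) (y≤x∨y _ _)

  infix 4 _⊲_
  _⊲_ : Rel (List Carrier) ℓ
  _⊲_ = Pointwise _≺_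

  ⊲-below : ∀ K → ∃[ M ] (M ⊲ K)
  ⊲-below []      = [] , []
  ⊲-below (k ∷ K) = let M , M⊲K = ⊲-below K in 𝟘 ∷ M , ↓.𝟘-closed k ∷ M⊲K

  ⊲-interpolate : ∀ {M K} → M ⊲ K → ∃[ Q ] (M ⊲ Q × Q ⊲ K)
  ⊲-interpolate []         = [] , [] , []
  ⊲-interpolate (m≺k ∷ ps) with ≺-interpolate m≺k | ⊲-interpolate ps
  ... | q , m≺q , q≺k | Q , M⊲Q , Q⊲K = q ∷ Q , m≺q ∷ M⊲Q , q≺k ∷ Q⊲K

  ⊲-upperBound : ∀ {M N K} → M ⊲ K → N ⊲ K → ∃[ P ] (P ⊲ K × ⋁ M ≤ ⋁ P × ⋁ N ≤ ⋁ P)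
  ⊲-upperBound [] [] = [] , [] , ≤-refl , ≤-refl
  ⊲-upperBound (m≺k ∷ ps) (n≺k ∷ qs) with ⊲-upperBound ps qs
  ... | P , P⊲K , M≤P , N≤P =
    _ ∷ P , ↓.∨-closed _ m≺k n≺k ∷ P⊲K , ∨-mono-≤ (x≤x∨y _ _) M≤P , ∨-mono-≤ (y≤x∨y _ _) N≤P

  ⋁-mono-⊲ : ∀ {M K} → M ⊲ K → ⋁ M ≺ ⋁ K
  ⋁-mono-⊲ = foldr⁺ ∨-mono-≺ (↓.𝟘-closed 𝟘)

  ⟦_⟧ : List Carrier → Pred Carrier ℓ
  ⟦ L ⟧ x = ∃[ M ] (M ⊲ L × x ≺ ⋁ M)

  ⟦⟧-isRoundedIdeal : ∀ L → IsRoundedIdeal _≤_ _≺_ ⟦ L ⟧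
  ⟦⟧-isRoundedIdeal L = record
    { downClosed = λ { x≤y (M , M⊲L , y≺M) → M , M⊲L , ≤-≺-trans x≤y y≺M }
    ; inhabited  = let M , M⊲L = ⊲-below L in 𝟘 , M , M⊲L , ↓.𝟘-closed (⋁ M)
    ; directed   = λ { {x} {y} (M , M⊲L , x≺M) (N , N⊲L , y≺N) →
        let P , P⊲L , M≤P , N≤P = ⊲-upperBound M⊲L N⊲L
        in x ∨ y , (P , P⊲L , ↓.∨-closed _ (≺-≤-trans x≺M M≤P) (≺-≤-trans y≺N N≤P))
         , x≤x∨y x y , y≤x∨y x y }
    ; rounded    = λ x → mk⇔
        (λ { (M , M⊲L , x≺M) → let y , x≺y , y≺M = ≺-interpolate x≺M in y , x≺y , M , M⊲L , y≺M })
        (λ { (y , x≺y , M , M⊲L , y≺M) → M , M⊲L , ≺-trans x≺y y≺M })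
    }

  ⋁-∈⟦⟧ : ∀ {N L} → N ⊲ L → ⋁ N ∈ ⟦ L ⟧
  ⋁-∈⟦⟧ N⊲L = let Q , N⊲Q , Q⊲L = ⊲-interpolate N⊲L in Q , Q⊲L , ⋁-mono-⊲ N⊲Q

  ⟦⟧⊆↓⋁ : ∀ L → ⟦ L ⟧ ⊆ ↓ (⋁ L)
  ⟦⟧⊆↓⋁ L (M , M⊲L , x≺M) = ≺-trans x≺M (⋁-mono-⊲ M⊲L)

  ⟦[]⟧⊆↓𝟘 : ⟦ [] ⟧ ⊆ ↓ 𝟘
  ⟦[]⟧⊆↓𝟘 = ⟦⟧⊆↓⋁ []

  ↓𝟘⊆⟦[]⟧ : ↓ 𝟘 ⊆ ⟦ [] ⟧
  ↓𝟘⊆⟦[]⟧ x≺𝟘 = [] , [] , x≺𝟘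

  ⟦[]⟧-least : ∀ {I} → IsRoundedIdeal _≤_ _≺_ I → ⟦ [] ⟧ ⊆ I
  ⟦[]⟧-least isI ([] , [] , x≺𝟘) = RoundedIdeal.≺-closed isI x≺𝟘 (RoundedIdeal.𝟘-closed isI)

  ⟦[_]⟧⊆↓ : ∀ a → ⟦ [ a ] ⟧ ⊆ ↓ a
  ⟦[ a ]⟧⊆↓ x∈⟦a⟧ = ≺-≤-trans (⟦⟧⊆↓⋁ [ a ] x∈⟦a⟧) (∨-least ≤-refl (minimum a))

  ↓⊆⟦[_]⟧ : ∀ a → ↓ a ⊆ ⟦ [ a ] ⟧
  ↓⊆⟦[ a ]⟧ x≺a = let m , x≺m , m≺a = ≺-interpolate x≺a in [ m ] , m≺a ∷ [] , ≺-≤-trans x≺m (x≤x∨y _ _)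

  ⟦⟧-++ˡ : ∀ L K → ⟦ L ⟧ ⊆ ⟦ L ++ K ⟧
  ⟦⟧-++ˡ L K (M , M⊲L , x≺M) =
    let N , N⊲K = ⊲-below K in M ++ N , ++⁺ M⊲L N⊲K , ≺-≤-trans x≺M (⋁-++ˡ M N)

  ⟦⟧-++ʳ : ∀ L K → ⟦ K ⟧ ⊆ ⟦ L ++ K ⟧
  ⟦⟧-++ʳ L K (M , M⊲K , x≺M) =
    let N , N⊲L = ⊲-below L in N ++ M , ++⁺ N⊲L M⊲K , ≺-≤-trans x≺M (⋁-++ʳ N M)

  ⟦⟧-++-least : ∀ {I} → IsRoundedIdeal _≤_ _≺_ I → ∀ L K → ⟦ L ⟧ ⊆ I → ⟦ K ⟧ ⊆ I → ⟦ L ++ K ⟧ ⊆ I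
  ⟦⟧-++-least isI L K L⊆I K⊆I (M , M⊲LK , x≺M) with pointwise-++⁻ʳ L K M⊲LK
  ... | N , N′ , refl , N⊲L , N′⊲K =
    ≺-closed x≺M (downClosed (⋁-++ N N′) (∨-closed (L⊆I (⋁-∈⟦⟧ N⊲L)) (K⊆I (⋁-∈⟦⟧ N′⊲K))))
    where open RoundedIdeal isI

  infix 4 _⋐_
  _⋐_ : List Carrier → Pred Carrier ℓ → Set ℓ
  L ⋐ I = ∃[ y ] (y ∈ I × ⟦ L ⟧ ⊆ ↓ y)

  ⋐-monotone : ∀ {I J L} → I ⊆ J → L ⋐ I → L ⋐ J
  ⋐-monotone I⊆J (y , y∈I , L⊆y) = y , I⊆J y∈I , L⊆y

  ⋐-antitone : ∀ {I L K} → ⟦ L ⟧ ⊆ ⟦ K ⟧ → K ⋐ I → L ⋐ I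
  ⋐-antitone L⊆K (y , y∈I , K⊆y) = y , y∈I , λ x∈L → K⊆y (L⊆K x∈L)

  ⋐-trans : ∀ {I L K} → L ⋐ ⟦ K ⟧ → K ⋐ I → L ⋐ I
  ⋐-trans (y , y∈K , L⊆y) (z , z∈I , K⊆z) = z , z∈I , λ x∈L → ≺-trans (L⊆y x∈L) (K⊆z y∈K)

  [-]-⋐ : ∀ {I y} → y ∈ I → [ y ] ⋐ I
  [-]-⋐ {y = y} y∈I = y , y∈I , ⟦[ y ]⟧⊆↓

  []-⋐ : ∀ {I} → IsRoundedIdeal _≤_ _≺_ I → [] ⋐ I
  []-⋐ isI = 𝟘 , RoundedIdeal.𝟘-closed isI , ⟦[]⟧⊆↓𝟘

  ⋐-++ : ∀ {I} → IsRoundedIdeal _≤_ _≺_ I → ∀ {L K} → L ⋐ I → K ⋐ I → L ++ K ⋐ I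
  ⋐-++ isI {L} {K} (y , y∈I , L⊆y) (z , z∈I , K⊆z) =
    y ∨ z , RoundedIdeal.∨-closed isI y∈I z∈I ,
    ⟦⟧-++-least (below-isRoundedIdeal (y ∨ z)) L K
      (λ x∈L → ≺-≤-trans (L⊆y x∈L) (x≤x∨y y z)) (λ x∈K → ≺-≤-trans (K⊆z x∈K) (y≤x∨y y z))

  ∈⇔∈⟦⟧⋐ : ∀ {I} → IsRoundedIdeal _≤_ _≺_ I → ∀ x → x ∈ I ⇔ (∃[ L ] (x ∈ ⟦ L ⟧ × L ⋐ I))
  ∈⇔∈⟦⟧⋐ isI x = mk⇔
    (λ x∈I → let y , x≺y , y∈I = RoundedIdeal.interpolate isI x∈I
             in [ y ] , ↓⊆⟦[ y ]⟧ x≺y , [-]-⋐ y∈I)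
    (λ { (L , x∈L , y , y∈I , L⊆y) → RoundedIdeal.≺-closed isI (L⊆y x∈L) y∈I })

  ⋐⇔⋐↓∈ : ∀ {I} → IsRoundedIdeal _≤_ _≺_ I → ∀ L → L ⋐ I ⇔ (∃[ a ] (L ⋐ ↓ a × a ∈ I))
  ⋐⇔⋐↓∈ isI L = mk⇔
    (λ { (y , y∈I , L⊆y) → let a , y≺a , a∈I = RoundedIdeal.interpolate isI y∈I
                           in a , (y , y≺a , L⊆y) , a∈I })
    (λ { (a , L⋐a , a∈I) → ⋐-monotone (λ x≺a → RoundedIdeal.≺-closed isI x≺a a∈I) L⋐a })

  infix 4 _⊑_ _⋖_
  _⊑_ : Rel (List Carrier) ℓ
  _⊑_ = _⊆_ on ⟦_⟧

  _⋖_ : Rel (List Carrier) ℓ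
  L ⋖ K = L ⋐ ⟦ K ⟧

  ⋐-interpolate : ∀ {I} → IsRoundedIdeal _≤_ _≺_ I → ∀ {L} → L ⋐ I → ∃[ K ] (L ⋖ K × K ⋐ I)
  ⋐-interpolate isI (y , y∈I , L⊆y) =
    let K , y∈K , K⋐I = Equivalence.to (∈⇔∈⟦⟧⋐ isI _) y∈I in K , (y , y∈K , L⊆y) , K⋐I

  ⋐-isRoundedIdeal : ∀ {I} → IsRoundedIdeal _≤_ _≺_ I → IsRoundedIdeal _⊑_ _⋖_ (_⋐ I)
  ⋐-isRoundedIdeal isI = record
    { downClosed = ⋐-antitone
    ; inhabited  = [] , []-⋐ isI
    ; directed   = λ {L} {K} L⋐I K⋐I →
        L ++ K , ⋐-++ isI L⋐I K⋐I , ⟦⟧-++ˡ L K , ⟦⟧-++ʳ L K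
    ; rounded    = λ L → mk⇔ (⋐-interpolate isI) (λ { (K , L⋖K , K⋐I) → ⋐-trans L⋖K K⋐I })
    }

  ⋖-isRoundedUpper : ∀ L → IsRoundedUpper _⊑_ _⋖_ (L ⋖_)
  ⋖-isRoundedUpper L = record
    { upClosed = ⋐-monotone
    ; rounded  = λ K → mk⇔ (λ L⋖K → map₂ swap (⋐-interpolate (⟦⟧-isRoundedIdeal K) L⋖K))
                           (λ { (K′ , K′⋖K , L⋖K′) → ⋐-trans L⋖K′ K′⋖K })
    }

  S⁺ : ProximityJoinSemilattice ℓ
  S⁺ = record
    { Carrier = List Carrier
    ; _≈_     = _≐ₚ_ on ⟦_⟧
    ; _≤_     = _⊑_
    ; _≺_     = _⋖_
    ; _∨_     = _++_
    ; 𝟘       = []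
    ; isBoundedJoinSemilattice = record
      { isJoinSemilattice = record
        { isPartialOrder = On.isPartialOrder ⟦_⟧ ⊆-isPartialOrder
        ; supremum = λ L K → ⟦⟧-++ˡ L K , ⟦⟧-++ʳ L K ,
                             λ M → ⟦⟧-++-least (⟦⟧-isRoundedIdeal M) L K
        }
      ; minimum = λ L → ⟦[]⟧-least (⟦⟧-isRoundedIdeal L)
      }
    ; below-isRoundedIdeal = λ K → ⋐-isRoundedIdeal (⟦⟧-isRoundedIdeal K)
    ; above-isRoundedUpper = ⋖-isRoundedUpper
    }

  ⊲⇒⋖ : ∀ {Q K} → Q ⊲ K → Q ⋖ K
  ⊲⇒⋖ {Q} Q⊲K = ⋁ Q , ⋁-∈⟦⟧ Q⊲K , ⟦⟧⊆↓⋁ Q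

  S⁺-isStrong : IsStrong S⁺
  S⁺-isStrong = record
    { ≺𝟘⇒≈𝟘    = λ { L (y , y∈⟦[]⟧ , L⊆y) →
        (λ x∈L → ↓𝟘⊆⟦[]⟧ (≺-trans (L⊆y x∈L) (⟦[]⟧⊆↓𝟘 y∈⟦[]⟧))) , ⟦[]⟧-least (⟦⟧-isRoundedIdeal L) }
    ; ≺∨-split = split
    }
    where
    split : ∀ L K K′ → L ⋖ (K ++ K′) → ∃[ B ] ∃[ C ] (L ⊑ (B ++ C) × B ⋖ K × C ⋖ K′)
    split L K K′ (y , (M , M⊲KK′ , y≺M) , L⊆y) with pointwise-++⁻ʳ K K′ M⊲KK′
    ... | N , N′ , refl , N⊲K , N′⊲K′ with ⊲-interpolate N⊲K | ⊲-interpolate N′⊲K′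
    ... | B , N⊲B , B⊲K | C , N′⊲C , C⊲K′ =
      B , C , (λ x∈L → N ++ N′ , ++⁺ N⊲B N′⊲C , ≺-trans (L⊆y x∈L) y≺M) , ⊲⇒⋖ B⊲K , ⊲⇒⋖ C⊲K′

  embed : PxHom S S⁺
  embed = record
    { rel          = λ a L → a ∈ ⟦ L ⟧
    ; approximable = record
      { ideal = ⟦⟧-isRoundedIdeal
      ; upper = λ a → record
        { upClosed = λ L⊆K a∈L → L⊆K a∈L
        ; rounded  = λ K → let module a∈K = Equivalence (∈⇔∈⟦⟧⋐ (⟦⟧-isRoundedIdeal K) a) in
            mk⇔ (λ a∈K → map₂ swap (a∈K.to a∈K)) (λ ∃L → a∈K.from (map₂ swap ∃L))
        }
      }
    }

  project : PxHom S⁺ S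
  project = record
    { rel          = λ L a → L ⋐ ↓ a
    ; approximable = record
      { ideal = λ a → ⋐-isRoundedIdeal (below-isRoundedIdeal a)
      ; upper = λ L → record
        { upClosed = λ a≤b → ⋐-monotone (λ x≺a → ≺-≤-trans x≺a a≤b)
        ; rounded  = λ a → let module L⋐a = Equivalence (⋐⇔⋐↓∈ (below-isRoundedIdeal a) L) in
            mk⇔ (λ L⋐a → map₂ swap (L⋐a.to L⋐a)) (λ ∃b → L⋐a.from (map₂ swap ∃b))
        }
      }
    }

  S≅S⁺ : PxIso S S⁺
  S≅S⁺ = record
    { to      = embed
    ; from    = project
    ; from∘to = λ a c → ⇔-sym (∈⇔∈⟦⟧⋐ (below-isRoundedIdeal c) a)
    ; to∘from = λ L K → ⇔-sym (⋐⇔⋐↓∈ (⟦⟧-isRoundedIdeal K) L)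
    }

proposition3p21 : ∀ {ℓ : Level} (S : ProximityJoinSemilattice ℓ) →
    Σ (ProximityJoinSemilattice ℓ) (λ S′ → IsStrong S′ × PxIso S S′)
proposition3p21 S = S⁺ , S⁺-isStrong , S≅S⁺
  where open StrongPresentation S
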